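{- The sequence $\{G_k\}_{k\ge 1}$ of Erdős–Hajnal shift graphs is a Ramsey sequence. In particular, it is an ascending sequence with $\omega(G_k)=2$ for all $k$ and $\lim_{k\to\infty}\chi(G_k)=\infty$ that is a Ramsey sequence.
   Context: For a positive integer $k$, the Erdős–Hajnal shift graph $G_k$ has vertex set $\{[i,j] : i,j \text{ integers}, 1 \le i < j \le 2^k+1\}$, and two vertices $[i,j]$ and $[\ell,m]$ are adjacent if and only if $j=\ell$ or $m=i$. (These graphs are triangle-free, so $\omega(G_k)=2$, and $\chi(G_k)=k+1$.) A sequence of graphs $\{H_k\}$ is ascending if $H_k$ is isomorphic to a proper subgraph of $H_{k+1}$ for every positive integer $k$. An ascending sequence $\{H_k\}$ is a Ramsey sequence if for every positive integer $k$ there exists an integer $n>k$ such that every red-blue coloring of the edges of $H_n$ contains a monochromatic (all red or all blue) subgraph isomorphic to $H_k$. -}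

module Defs where

open import Level using (0ℓ)
open import Data.Nat using (ℕ; suc; _≤_; _<_; _^_; _+_)
open import Data.Bool using (Bool)
open import Data.Product using (Σ; ∃; ∃-syntax; _×_; _,_)
open import Data.Sum using (_⊎_)
open import Relation.Binary.PropositionalEquality using (_≡_)
open import Relation.Nullary using (¬_)

record Graph : Set₁ where
  field
    V   : Set
    Adj : V → V → Set
open Graph public

-- H is isomorphic to a subgraph of G: an injective vertex map preserving adjacency.
record Embedding (H G : Graph) : Set where
  field
    map       : V H → V G
    injective : ∀ {x y} → map x ≡ map y → x ≡ y
    preserves : ∀ {x y} → Adj H x y → Adj G (map x) (map y)
open Embedding public

-- H is isomorphic to a PROPER subgraph of G: the image subgraph misses
-- some vertex of G or some edge of G.
ProperEmbedding : Graph → Graph → Set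
ProperEmbedding H G =
  Σ (Embedding H G) λ f →
    (∃[ v ] (∀ x → ¬ (map f x ≡ v)))
    ⊎ (∃[ x ] ∃[ y ] (Adj G (map f x) (map f y) × ¬ Adj H x y))

-- A sequence H₁, H₂, … (indexed by positive integers; H 0 is ignored).
Ascending : (ℕ → Graph) → Set
Ascending H = ∀ k → 1 ≤ k → ProperEmbedding (H k) (H (suc k))

-- red-blue colouring of the edges of G (an edge {x,y} gets colour c x y,
-- required to be independent of orientation)
record EdgeColouring (G : Graph) : Set where
  field
    colour : ∀ x y → Adj G x y → Bool
    sym    : ∀ x y (e : Adj G x y) (e' : Adj G y x) → colour x y e ≡ colour y x e'
open EdgeColouring public

MonoCopy : (H G : Graph) → EdgeColouring G → Set
MonoCopy H G c =
  ∃[ b ] Σ (Embedding H G) λ f →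
    ∀ x y (e : Adj H x y) → colour c (map f x) (map f y) (preserves f e) ≡ b

IsRamseySequence : (ℕ → Graph) → Set
IsRamseySequence H =
  Ascending H ×
  (∀ k → 1 ≤ k → ∃[ n ] (k < n × (∀ (c : EdgeColouring (H n)) → MonoCopy (H k) (H n) c)))

record ShiftVertex (k : ℕ) : Set where
  constructor [_,_]⟨_,_,_⟩
  field
    i   : ℕ
    j   : ℕ
    1≤i : 1 ≤ i
    i<j : i < j
    j≤  : j ≤ 2 ^ k + 1
open ShiftVertex public

ShiftGraph : ℕ → Graph
ShiftGraph k = record
  { V   = ShiftVertex k
  ; Adj = λ u w → j u ≡ i w ⊎ j w ≡ i u
  }

-- Colour each triple p < q < r of {1, …, 2^n + 1} by the colour of the edge
-- [p,q] ~ [q,r] of G_n.  Ramsey's theorem for triples gives, for n large, a set U of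
-- 2^k + 1 such points all of whose triples have the same colour.  The increasing
-- bijection φ : {1, …, 2^k + 1} → U then maps G_k onto a monochromatic copy in G_n,
-- since every edge of G_k has the form [a,b] ~ [b,c] with a < b < c.
-- G_k is the subgraph of G_{k+1} on the vertices with j ≤ 2^k + 1; it misses [1, 2^(k+1) + 1].
module Submission where

open import Defs
open import Data.Bool using (Bool; true; false)
open import Data.List using (List; []; _∷_; length; applyUpTo)
open import Data.List.Properties using (length-applyUpTo)
open import Data.List.Relation.Binary.Sublist.Propositional
  using (_⊆_; []; _∷_; _∷ʳ_; minimum; ⊆-refl; ⊆-trans)
open import Data.List.Relation.Binary.Sublist.Propositional.Properties using (All-resp-⊆)
open import Data.List.Relation.Unary.All as All using (All; []; _∷_)
open import Data.List.Relation.Unary.AllPairs as AllPairs using (AllPairs; []; _∷_)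
import Data.List.Relation.Unary.All.Properties as All
import Data.List.Relation.Unary.AllPairs.Properties as AllPairs
open import Data.Nat
open import Data.Nat.Properties
open import Data.Product using (∃-syntax; _×_; _,_; proj₁; proj₂)
open import Data.Sum using (_⊎_; inj₁; inj₂; swap) renaming (map to ⊎-map)
open import Function using (_∘_)
open import Relation.Binary.Definitions using (tri<; tri≈; tri>)
open import Relation.Binary.PropositionalEquality
  using (_≡_; refl; cong; subst; trans) renaming (sym to ≡-sym)
open import Relation.Nullary using (¬_; yes; no; contradiction)

AllPairs-resp-⊆ : ∀ {A : Set} {R : A → A → Set} {xs ys : List A} →
                  xs ⊆ ys → AllPairs R ys → AllPairs R xs
AllPairs-resp-⊆ []         []         = []
AllPairs-resp-⊆ (_ ∷ʳ p)   (_ ∷ rys)  = AllPairs-resp-⊆ p rys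
AllPairs-resp-⊆ (refl ∷ p) (ry ∷ rys) = All-resp-⊆ p ry ∷ AllPairs-resp-⊆ p rys

ramseyNumber : ℕ → ℕ → ℕ → ℕ
ramseyNumber zero    s       t       = s + t
ramseyNumber (suc r) zero    t       = 0
ramseyNumber (suc r) (suc s) zero    = 0
ramseyNumber (suc r) (suc s) (suc t) =
  suc (ramseyNumber r (ramseyNumber (suc r) s (suc t)) (ramseyNumber (suc r) (suc s) t))

module _ {A : Set} where

  Homogeneous : ℕ → (List A → Bool) → Bool → List A → Set
  Homogeneous r χ b U = ∀ T → T ⊆ U → length T ≡ r → χ T ≡ b

  HasHomogeneousSublist : ℕ → (List A → Bool) → ℕ → ℕ → List A → Set
  HasHomogeneousSublist r χ s t xs =
    ∃[ U ] U ⊆ xs × (s ≤ length U × Homogeneous r χ true U ⊎ t ≤ length U × Homogeneous r χ false U)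

  Ramsey : ℕ → Set
  Ramsey r = ∀ s t (χ : List A → Bool) xs →
             ramseyNumber r s t ≤ length xs → HasHomogeneousSublist r χ s t xs

  homogeneous-zero : ∀ {χ b U} → χ [] ≡ b → Homogeneous 0 χ b U
  homogeneous-zero χ[]≡b [] _ _ = χ[]≡b

  homogeneous-[] : ∀ {r χ b} → Homogeneous (suc r) χ b []
  homogeneous-[] _ [] ()

  homogeneous-∷ : ∀ {r χ b x T U} → Homogeneous r (χ ∘ (x ∷_)) b T → U ⊆ T →
                  Homogeneous (suc r) χ b U → Homogeneous (suc r) χ b (x ∷ U)
  homogeneous-∷ hT U⊆T hU S       (_ ∷ʳ S⊆U)   len = hU S S⊆U len
  homogeneous-∷ hT U⊆T hU (_ ∷ S) (refl ∷ S⊆U) len = hT S (⊆-trans S⊆U U⊆T) (suc-injective len)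

  ramsey-zero : Ramsey 0
  ramsey-zero s t χ xs big with χ [] in χ[]
  ... | true  = xs , ⊆-refl , inj₁ (≤-trans (m≤m+n s t) big , homogeneous-zero χ[])
  ... | false = xs , ⊆-refl , inj₂ (≤-trans (m≤n+m t s) big , homogeneous-zero χ[])

  -- The first element x induces the colouring T ↦ χ (x ∷ T) of the r-subsets of the
  -- rest; inside a homogeneous set for it, recurse on whichever of s, t its colour serves.
  ramsey-suc : ∀ {r} → Ramsey r → Ramsey (suc r)
  ramsey-suc ih zero    t       χ xs       _ = [] , minimum xs , inj₁ (z≤n , homogeneous-[])
  ramsey-suc ih (suc s) zero    χ xs       _ = [] , minimum xs , inj₂ (z≤n , homogeneous-[])
  ramsey-suc ih (suc s) (suc t) χ (x ∷ xs) (s≤s big) with ih _ _ (χ ∘ (x ∷_)) xs big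
  ... | T , T⊆xs , inj₁ (bigT , hT) with ramsey-suc ih s (suc t) χ T bigT
  ...   | U , U⊆T , inj₁ (s≤U , hU) =
            x ∷ U , refl ∷ ⊆-trans U⊆T T⊆xs , inj₁ (s≤s s≤U , homogeneous-∷ hT U⊆T hU)
  ...   | U , U⊆T , inj₂ big-false = U , x ∷ʳ ⊆-trans U⊆T T⊆xs , inj₂ big-false
  ramsey-suc ih (suc s) (suc t) χ (x ∷ xs) (s≤s big)
      | T , T⊆xs , inj₂ (bigT , hT) with ramsey-suc ih (suc s) t χ T bigT
  ...   | U , U⊆T , inj₂ (t≤U , hU) =
            x ∷ U , refl ∷ ⊆-trans U⊆T T⊆xs , inj₂ (s≤s t≤U , homogeneous-∷ hT U⊆T hU)
  ...   | U , U⊆T , inj₁ big-true = U , x ∷ʳ ⊆-trans U⊆T T⊆xs , inj₁ big-true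

  ramsey : ∀ r → Ramsey r
  ramsey zero    = ramsey-zero
  ramsey (suc r) = ramsey-suc (ramsey r)

nth : List ℕ → ℕ → ℕ
nth []       _       = 0
nth (x ∷ xs) zero    = x
nth (x ∷ xs) (suc a) = nth xs a

nth-⊆ : ∀ {xs a} → a < length xs → nth xs a ∷ [] ⊆ xs
nth-⊆ {x ∷ xs} {zero}  _         = refl ∷ minimum xs
nth-⊆ {x ∷ xs} {suc a} (s≤s a<) = x ∷ʳ nth-⊆ a<

nth-pair-⊆ : ∀ {xs a b} → a < b → b < length xs → nth xs a ∷ nth xs b ∷ [] ⊆ xs
nth-pair-⊆ {x ∷ xs} {zero}  {suc b} _          (s≤s b<) = refl ∷ nth-⊆ b<
nth-pair-⊆ {x ∷ xs} {suc a} {suc b} (s≤s a<b) (s≤s b<) = x ∷ʳ nth-pair-⊆ a<b b<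

nth-triple-⊆ : ∀ {xs a b c} → a < b → b < c → c < length xs →
               nth xs a ∷ nth xs b ∷ nth xs c ∷ [] ⊆ xs
nth-triple-⊆ {x ∷ xs} {zero}  {suc b} {suc c} _          (s≤s b<c) (s≤s c<) = refl ∷ nth-pair-⊆ b<c c<
nth-triple-⊆ {x ∷ xs} {suc a} {suc b} {suc c} (s≤s a<b) (s≤s b<c) (s≤s c<) = x ∷ʳ nth-triple-⊆ a<b b<c c<

fromOneTo : ℕ → List ℕ
fromOneTo N = applyUpTo suc N

fromOneTo-pair : ∀ {N x y} → x ∷ y ∷ [] ⊆ fromOneTo N → 1 ≤ x × x < y × y ≤ N
fromOneTo-pair {N} xy⊆
  with All-resp-⊆ xy⊆ (All.applyUpTo⁺₁ {P = λ x → 1 ≤ x × x ≤ N} suc N (λ i<N → s≤s z≤n , i<N))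
     | AllPairs-resp-⊆ xy⊆ (AllPairs.applyUpTo⁺₁ {R = _<_} suc N (λ i<j _ → s≤s i<j))
... | (1≤x , _) ∷ (_ , y≤N) ∷ [] | (x<y ∷ []) ∷ _ = 1≤x , x<y , y≤N

n<2^n : ∀ n → n < 2 ^ n
n<2^n zero    = z<s
n<2^n (suc n) = ≤-<-trans (n<2^n n) (^-monoʳ-< 2 (s≤s (s≤s z≤n)) (n<1+n n))

colour-irrelevant : ∀ {G} (c : EdgeColouring G) {x y} → Adj G y x →
                    (e e' : Adj G x y) → colour c x y e ≡ colour c x y e'
colour-irrelevant c {x} {y} f e e' = trans (sym c x y e f) (≡-sym (sym c x y e' f))

module _ {k : ℕ} where

  1≤j : (u : ShiftVertex k) → 1 ≤ j u
  1≤j u = ≤-trans (1≤i u) (<⇒≤ (i<j u))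

  i≤ : (u : ShiftVertex k) → i u ≤ 2 ^ k + 1
  i≤ u = <⇒≤ (<-≤-trans (i<j u) (j≤ u))

  ShiftVertex-≡ : ∀ {u w : ShiftVertex k} → i u ≡ i w → j u ≡ j w → u ≡ w
  ShiftVertex-≡ {[ _ , _ ]⟨ p , q , r ⟩} {[ _ , _ ]⟨ p' , q' , r' ⟩} refl refl
    rewrite ≤-irrelevant p p' | ≤-irrelevant q q' | ≤-irrelevant r r' = refl

  shiftColour-cong : (c : EdgeColouring (ShiftGraph k)) {u u' w w' : ShiftVertex k}
                     (e : Adj (ShiftGraph k) u w) (e' : Adj (ShiftGraph k) u' w') →
                     u ≡ u' → w ≡ w' → colour c u w e ≡ colour c u' w' e'
  shiftColour-cong c e e' refl refl = colour-irrelevant c (swap e) e e'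

2^k+1<2^[1+k]+1 : ∀ k → 2 ^ k + 1 < 2 ^ suc k + 1
2^k+1<2^[1+k]+1 k = +-monoˡ-< 1 (^-monoʳ-< 2 (s≤s (s≤s z≤n)) (n<1+n k))

shiftGraph-ascending : Ascending ShiftGraph
shiftGraph-ascending k _ = inclusion , inj₁ (corner , corner∉image)
  where
  widen : ShiftVertex k → ShiftVertex (suc k)
  widen u = [ i u , j u ]⟨ 1≤i u , i<j u , ≤-trans (j≤ u) (<⇒≤ (2^k+1<2^[1+k]+1 k)) ⟩

  inclusion : Embedding (ShiftGraph k) (ShiftGraph (suc k))
  inclusion = record
    { map       = widen
    ; injective = λ eq → ShiftVertex-≡ (cong i eq) (cong j eq)
    ; preserves = λ e → e
    }

  corner : ShiftVertex (suc k)
  corner = [ 1 , 2 ^ suc k + 1 ]⟨ s≤s z≤n , +-monoˡ-< 1 (m^n>0 2 (suc k)) , ≤-refl ⟩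

  corner∉image : ∀ u → ¬ widen u ≡ corner
  corner∉image u eq = <⇒≱ (2^k+1<2^[1+k]+1 k) (subst (_≤ 2 ^ k + 1) (cong j eq) (j≤ u))

-- Lists other than increasing triples in {1, …, 2^n + 1} get the junk colour false.
pathColour : ∀ {n} → EdgeColouring (ShiftGraph n) → List ℕ → Bool
pathColour {n} c (p ∷ q ∷ r ∷ []) with 1 ≤? p | p <? q | q <? r | r ≤? 2 ^ n + 1
... | yes 1≤p | yes p<q | yes q<r | yes r≤ =
  colour c [ p , q ]⟨ 1≤p , p<q , ≤-trans (<⇒≤ q<r) r≤ ⟩
           [ q , r ]⟨ ≤-trans 1≤p (<⇒≤ p<q) , q<r , r≤ ⟩ (inj₁ refl)
... | _ | _ | _ | _ = false
pathColour c _ = false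

pathColour-edge : ∀ {n} (c : EdgeColouring (ShiftGraph n)) (u w : ShiftVertex n) (e : j u ≡ i w) →
                  pathColour c (i u ∷ j u ∷ j w ∷ []) ≡ colour c u w (inj₁ e)
pathColour-edge {n} c u w e with 1 ≤? i u | i u <? j u | j u <? j w | j w ≤? 2 ^ n + 1
... | yes _ | yes _ | yes _ | yes _ =
  shiftColour-cong c (inj₁ refl) (inj₁ e) (ShiftVertex-≡ refl refl) (ShiftVertex-≡ e refl)
... | no ¬1≤i | _ | _ | _ = contradiction (1≤i u) ¬1≤i
... | yes _ | no ¬i<j | _ | _ = contradiction (i<j u) ¬i<j
... | yes _ | yes _ | no ¬j<j | _ = contradiction (subst (_< j w) (≡-sym e) (i<j w)) ¬j<j
... | yes _ | yes _ | yes _ | no ¬j≤ = contradiction (j≤ w) ¬j≤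

module MonochromaticCopy
  (k n : ℕ) (c : EdgeColouring (ShiftGraph n)) (β : Bool) (U : List ℕ)
  (U⊆ : U ⊆ fromOneTo (2 ^ n + 1)) (long : 2 ^ k + 1 ≤ length U)
  (hom : Homogeneous 3 (pathColour c) β U)
  where

  φ : ℕ → ℕ
  φ p = nth U (pred p)

  φ-bounds : ∀ {p q} → 1 ≤ p → p < q → q ≤ 2 ^ k + 1 → 1 ≤ φ p × φ p < φ q × φ q ≤ 2 ^ n + 1
  φ-bounds (s≤s z≤n) (s≤s p<q) q≤ = fromOneTo-pair (⊆-trans (nth-pair-⊆ p<q (<-≤-trans q≤ long)) U⊆)

  φ-injective : ∀ {p q} → 1 ≤ p → p ≤ 2 ^ k + 1 → 1 ≤ q → q ≤ 2 ^ k + 1 → φ p ≡ φ q → p ≡ q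
  φ-injective {p} {q} 1≤p p≤ 1≤q q≤ φp≡φq with <-cmp p q
  ... | tri< p<q _ _ = contradiction φp≡φq (<⇒≢ (proj₁ (proj₂ (φ-bounds 1≤p p<q q≤))))
  ... | tri≈ _ p≡q _ = p≡q
  ... | tri> _ _ q<p = contradiction (≡-sym φp≡φq) (<⇒≢ (proj₁ (proj₂ (φ-bounds 1≤q q<p p≤))))

  φ-colour : ∀ {p q r} → 1 ≤ p → p < q → q < r → r ≤ 2 ^ k + 1 →
             pathColour c (φ p ∷ φ q ∷ φ r ∷ []) ≡ β
  φ-colour (s≤s z≤n) (s≤s p<q) (s≤s q<r) r≤ =
    hom _ (nth-triple-⊆ p<q q<r (<-≤-trans r≤ long)) refl

  vertex : ShiftVertex k → ShiftVertex n
  vertex u = let (1≤φi , φi<φj , φj≤) = φ-bounds (1≤i u) (i<j u) (j≤ u) in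
             [ φ (i u) , φ (j u) ]⟨ 1≤φi , φi<φj , φj≤ ⟩

  vertex-injective : ∀ {u w} → vertex u ≡ vertex w → u ≡ w
  vertex-injective {u} {w} eq = ShiftVertex-≡
    (φ-injective (1≤i u) (i≤ u) (1≤i w) (i≤ w) (cong i eq))
    (φ-injective (1≤j u) (j≤ u) (1≤j w) (j≤ w) (cong j eq))

  embedding : Embedding (ShiftGraph k) (ShiftGraph n)
  embedding = record
    { map       = vertex
    ; injective = vertex-injective
    ; preserves = ⊎-map (cong φ) (cong φ)
    }

  edge-colour : ∀ u w (e : j u ≡ i w) → colour c (vertex u) (vertex w) (inj₁ (cong φ e)) ≡ β
  edge-colour u w e = trans
    (≡-sym (pathColour-edge c (vertex u) (vertex w) (cong φ e)))
    (φ-colour (1≤i u) (i<j u) (subst (_< j w) (≡-sym e) (i<j w)) (j≤ w))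

  copy : MonoCopy (ShiftGraph k) (ShiftGraph n) c
  copy = β , embedding , monochromatic
    where
    monochromatic : ∀ u w (e : Adj (ShiftGraph k) u w) →
                    colour c (vertex u) (vertex w) (preserves embedding {u} {w} e) ≡ β
    monochromatic u w (inj₁ e) = edge-colour u w e
    monochromatic u w (inj₂ e) = trans (sym c _ _ _ (inj₁ (cong φ e))) (edge-colour w u e)

shiftGraph-ramsey : ∀ k → ∃[ n ] (k < n × ∀ c → MonoCopy (ShiftGraph k) (ShiftGraph n) c)
shiftGraph-ramsey k = n , s≤s (m≤m+n k R) , copy
  where
  M = 2 ^ k + 1
  R = ramseyNumber 3 M M
  n = suc (k + R)

  enough : R ≤ length (fromOneTo (2 ^ n + 1))
  enough = begin
    R                              ≤⟨ m≤n+m R k ⟩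
    k + R                          <⟨ n<1+n (k + R) ⟩
    n                              <⟨ n<2^n n ⟩
    2 ^ n                          ≤⟨ m≤m+n (2 ^ n) 1 ⟩
    2 ^ n + 1                      ≡⟨ length-applyUpTo suc (2 ^ n + 1) ⟨
    length (fromOneTo (2 ^ n + 1)) ∎
    where open ≤-Reasoning

  copy : ∀ c → MonoCopy (ShiftGraph k) (ShiftGraph n) c
  copy c with ramsey 3 M M (pathColour c) (fromOneTo (2 ^ n + 1)) enough
  ... | U , U⊆ , inj₁ (long , hom) = MonochromaticCopy.copy k n c true  U U⊆ long hom
  ... | U , U⊆ , inj₂ (long , hom) = MonochromaticCopy.copy k n c false U U⊆ long hom

theorem4 : IsRamseySequence ShiftGraph
theorem4 = shiftGraph-ascending , λ k _ → shiftGraph-ramsey k
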